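{- Let $g$ be a positive integer, $G=\mathbb{Z}/g\mathbb{Z}$, and $X\subset G$ with $0\in X$. Let $a,b$ be positive integers with $\gcd(a,b)=1$. Assume that $X$ is not periodic and that $aX+bX=aX$. Then $$X\subset\frac{g}{\gcd(g,b)}G.$$
   Context: For $k\in\mathbb{Z}$ and $S\subset G$, $kS=\{ks\mid s\in S\}$; $aX+bX=\{ax+bx'\mid x,x'\in X\}$. The period of $X$ is the largest subgroup $H$ of $G$ with $X+H=X$; $X$ is periodic if this subgroup is nontrivial. -}

module Defs where

open import Data.Nat using (ℕ; _+_; _*_; NonZero)
open import Data.Nat.DivMod using (_mod_)
open import Data.Nat.Divisibility using (_∣_; quotient)
open import Data.Nat.GCD using (gcd; gcd[m,n]∣m)
open import Data.Fin using (Fin; toℕ)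
open import Data.Product using (Σ; _×_; ∃)
open import Relation.Binary.PropositionalEquality using (_≡_; _≢_)
open import Relation.Unary using (Pred; _⊆_)
open import Function.Bundles using (_⇔_)
open import Level using (0ℓ)

module _ (g : ℕ) .{{_ : NonZero g}} where

  G : Set
  G = Fin g

  _⊕_ : G → G → G
  x ⊕ y = (toℕ x + toℕ y) mod g

  𝟘 : G
  𝟘 = 0 mod g

  ⊖_ : G → G
  ⊖ x = (g Data.Nat.∸ toℕ x) mod g

  _·_ : ℕ → G → G
  k · x = (k * toℕ x) mod g

  Subset : Set₁
  Subset = Pred G 0ℓ

  scale : ℕ → Subset → Subset
  scale k S z = ∃ λ s → S s × z ≡ k · s

  dilSum : ℕ → ℕ → Subset → Subset
  dilSum a b X z = Σ G λ x → Σ G λ x' → X x × X x' × z ≡ (a · x) ⊕ (b · x')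

  _⊞_ : Subset → Subset → Subset
  (S ⊞ H) z = Σ G λ s → Σ G λ h → S s × H h × z ≡ s ⊕ h

  _≐_ : Subset → Subset → Set
  S ≐ T = ∀ z → (S z ⇔ T z)

  record IsSubgroup (H : Subset) : Set where
    field
      has-zero : H 𝟘
      closed-+ : ∀ {x y} → H x → H y → H (x ⊕ y)
      closed-- : ∀ {x} → H x → H (⊖ x)

  -- X is periodic iff its period (the largest subgroup H with X + H = X)
  -- is nontrivial, i.e. iff some nontrivial subgroup H satisfies X + H = X.
  Periodic : Subset → Set₁
  Periodic X = Σ Subset λ H → IsSubgroup H × (X ⊞ H) ≐ X × (∃ λ h → H h × h ≢ 𝟘)

  multiplesOf : ℕ → Subset
  multiplesOf k z = ∃ λ y → z ≡ k · y

g/gcd : ℕ → ℕ → ℕ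
g/gcd g b = quotient (gcd[m,n]∣m g b)

module Submission where

-- Taking x = 0 in aX + bX = aX gives, for
-- every y ∈ X, some s₀ ∈ X with b·y = a·s₀.  Then for every x ∈ X,
-- a·(x + s₀) = a·x + b·y ∈ aX, i.e. a·(x + s₀) = a·s for some s ∈ X.
-- If multiplication by a could be cancelled we would get X + s₀ ⊆ X, so s₀
-- generates a period of X; as X is not periodic, s₀ = 0, hence g ∣ b·y, which
-- says exactly that y is a multiple of g / gcd(g, b).
--
-- Cancellation of a is the only real difficulty.  The divisors
-- M_k = gcd(a^k, g) form an ascending chain of divisors of g, hence stabilise
-- at some K; on multiples of M = M_K, multiplication by a is injective mod g.
-- Using gcd(a, b) = 1 one shows by induction on k that every element of X is
-- a multiple of M_k, so a can be cancelled on X.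

open import Defs
open import Data.Nat using (ℕ; zero; suc; pred; _+_; _*_; _∸_; _^_; _≤_; _<_; z≤n; s≤s; NonZero; ≢-nonZero; ≢-nonZero⁻¹; >-nonZero⁻¹)
open import Data.Nat.Properties
open import Data.Nat.DivMod
open import Data.Nat.Divisibility
open import Data.Nat.GCD using (gcd; gcd[m,n]∣m; gcd[m,n]∣n; gcd-greatest; gcd-comm; c*gcd[m,n]≡gcd[cm,cn]; gcd[m,n]≡0⇒m≡0)
open import Data.Nat.Coprimality using (Coprime; coprime-divisor; gcd≡1⇒coprime)
open import Data.Fin using (toℕ) renaming (_≟_ to _≟ᴳ_)
open import Data.Fin.Properties using (toℕ-fromℕ<; toℕ-injective; toℕ<n)
open import Data.Product using (_×_; ∃; _,_; proj₁; proj₂)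
open import Data.Sum using (_⊎_; inj₁; inj₂; [_,_])
open import Data.Empty using (⊥-elim)
open import Function.Bundles using (Equivalence; mk⇔)
open import Relation.Nullary using (¬_; yes; no)
open import Relation.Binary.PropositionalEquality using (_≡_; _≢_; refl; sym; trans; cong; cong₂; subst; module ≡-Reasoning)
open import Relation.Unary using (_⊆_)

divisor-chain-stabilises : (n : ℕ) .{{_ : NonZero n}} (f : ℕ → ℕ) →
  (∀ k → f k ∣ f (suc k)) → (∀ k → f k ∣ n) → ∃ λ k → f (suc k) ∣ f k
divisor-chain-stabilises n f step bound =
  [ (λ stable → stable) , (λ n<f → ⊥-elim (≤⇒≯ (∣⇒≤ (bound (suc n))) n<f)) ] (grows (suc n))
  where
  nonZero : ∀ k → NonZero (f k)
  nonZero k = ≢-nonZero (λ fk≡0 → ≢-nonZero⁻¹ n (0∣⇒≡0 (subst (_∣ n) fk≡0 (bound k))))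

  grows : ∀ k → (∃ λ j → f (suc j) ∣ f j) ⊎ (k ≤ f k)
  grows zero = inj₂ z≤n
  grows (suc k) with grows k | f (suc k) ∣? f k
  ... | inj₁ stable | _ = inj₁ stable
  ... | inj₂ _ | yes back = inj₁ (k , back)
  ... | inj₂ k≤fk | no ¬back = inj₂ (<-≤-trans (s≤s k≤fk) fk<fsk)
    where
    instance _ = nonZero (suc k)
    fk<fsk : f k < f (suc k)
    fk<fsk = ≤∧≢⇒< (∣⇒≤ (step k)) (λ e → ¬back (subst (f (suc k) ∣_) (sym e) ∣-refl))

coprime-pow : ∀ {a b} → Coprime a b → ∀ k → Coprime (a ^ k) b
coprime-pow _ zero (i∣1 , _) = ∣1⇒≡1 i∣1
coprime-pow {a} {b} a⊥b (suc k) (i∣a*aᵏ , i∣b) =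
  coprime-pow a⊥b k (coprime-divisor i⊥a i∣a*aᵏ , i∣b)
  where
  i⊥a : Coprime _ a
  i⊥a (j∣i , j∣a) = a⊥b (j∣a , ∣-trans j∣i i∣b)

gcd-*-∣-*-gcd : ∀ a c g → gcd (a * c) g ∣ a * gcd c g
gcd-*-∣-*-gcd a c g = subst (gcd (a * c) g ∣_) (sym (c*gcd[m,n]≡gcd[cm,cn] a c g))
  (gcd-greatest (gcd[m,n]∣m (a * c) g) (∣-trans (gcd[m,n]∣n (a * c) g) (n∣m*n a)))

gcd-*-gcd-∣-gcd-* : ∀ a c g → gcd (a * gcd c g) g ∣ gcd (a * c) g
gcd-*-gcd-∣-gcd-* a c g =
  gcd-greatest (∣-trans (gcd[m,n]∣m (a * gcd c g) g) (*-monoʳ-∣ a (gcd[m,n]∣m c g)))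
    (gcd[m,n]∣n (a * gcd c g) g)

stable-cancel : ∀ a {g M w} → gcd (a * M) g ∣ M → g ∣ a * w → M ∣ w → g ∣ w
stable-cancel a {g} {M} stable g∣a*w (divides q refl) =
  ∣-trans g∣gcd (subst (_∣ q * M) (c*gcd[m,n]≡gcd[cm,cn] q (a * M) g) (*-monoʳ-∣ q stable))
  where
  a*[q*M]≡q*[a*M] : a * (q * M) ≡ q * (a * M)
  a*[q*M]≡q*[a*M] = trans (sym (*-assoc a q M)) (trans (cong (_* M) (*-comm a q)) (*-assoc q a M))
  g∣gcd : g ∣ gcd (q * (a * M)) (q * g)
  g∣gcd = gcd-greatest (subst (g ∣_) a*[q*M]≡q*[a*M] g∣a*w) (n∣m*n q)

cofactor-∣ : ∀ g b y .{{_ : NonZero g}} → g ∣ b * y → g/gcd g b ∣ y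
cofactor-∣ g b y g∣b*y = *-cancelʳ-∣ (gcd g b) (subst (_∣ y * gcd g b) g≡q*d g∣y*d)
  where
  instance _ = ≢-nonZero (λ d≡0 → ≢-nonZero⁻¹ g (gcd[m,n]≡0⇒m≡0 d≡0))
  g≡q*d : g ≡ g/gcd g b * gcd g b
  g≡q*d = m∣n⇒n≡quotient*m (gcd[m,n]∣m g b)
  g∣y*d : g ∣ y * gcd g b
  g∣y*d = subst (g ∣_) (trans (sym (c*gcd[m,n]≡gcd[cm,cn] y b g)) (cong (y *_) (gcd-comm b g)))
    (gcd-greatest (subst (g ∣_) (*-comm b y) g∣b*y) (n∣m*n y))

module Residues (g : ℕ) .{{_ : NonZero g}} where

  infix 4 _≋_
  infixl 6 _+ᴳ_
  infixr 7 _·ᴳ_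

  _≋_ : ℕ → ℕ → Set
  p ≋ q = p % g ≡ q % g

  _+ᴳ_ : G g → G g → G g
  _+ᴳ_ = _⊕_ g

  _·ᴳ_ : ℕ → G g → G g
  _·ᴳ_ = _·_ g

  0ᴳ : G g
  0ᴳ = 𝟘 g

  toℕ-mod : ∀ p → toℕ (p mod g) ≋ p
  toℕ-mod p = trans (cong (_% g) (toℕ-fromℕ< _)) (m%n%n≡m%n p g)

  +-cong : ∀ {p p' q q'} → p ≋ p' → q ≋ q' → p + q ≋ p' + q'
  +-cong {p} {p'} {q} {q'} p≋p' q≋q' = trans (%-distribˡ-+ p q g)
    (trans (cong₂ (λ u v → (u + v) % g) p≋p' q≋q') (sym (%-distribˡ-+ p' q' g)))

  *-congˡ : ∀ k {p p'} → p ≋ p' → k * p ≋ k * p'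
  *-congˡ k {p} {p'} p≋p' = trans (%-distribˡ-* k p g)
    (trans (cong (λ u → ((k % g) * u) % g) p≋p') (sym (%-distribˡ-* k p' g)))

  0%g≡0 : 0 % g ≡ 0
  0%g≡0 = m<n⇒m%n≡m (>-nonZero⁻¹ g)

  ≋⇒≡ : ∀ {x y : G g} → toℕ x ≋ toℕ y → x ≡ y
  ≋⇒≡ {x} {y} x≋y = toℕ-injective
    (trans (sym (m<n⇒m%n≡m (toℕ<n x))) (trans x≋y (m<n⇒m%n≡m (toℕ<n y))))

  ≋⇒∣∸ : ∀ {u v} → u ≤ v → u ≋ v → g ∣ v ∸ u
  ≋⇒∣∸ {u} {v} u≤v u≋v = divides (v / g ∸ u / g) (begin
      v ∸ u
        ≡⟨ cong₂ _∸_ (m≡m%n+[m/n]*n v g) (m≡m%n+[m/n]*n u g) ⟩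
      (v % g + (v / g) * g) ∸ (u % g + (u / g) * g)
        ≡⟨ cong (λ r → (v % g + (v / g) * g) ∸ (r + (u / g) * g)) u≋v ⟩
      (v % g + (v / g) * g) ∸ (v % g + (u / g) * g)
        ≡⟨ [m+n]∸[m+o]≡n∸o (v % g) _ _ ⟩
      (v / g) * g ∸ (u / g) * g
        ≡⟨ sym (*-distribʳ-∸ g (v / g) (u / g)) ⟩
      (v / g ∸ u / g) * g ∎)
    where open ≡-Reasoning

  ∣∸⇒≋ : ∀ {u v} → u ≤ v → g ∣ v ∸ u → u ≋ v
  ∣∸⇒≋ {u} {v} u≤v g∣v∸u =
    sym (trans (cong (_% g) (sym (m+[n∸m]≡n u≤v))) (%-remove-+ʳ u g∣v∸u))

  ≋0⇒∣ : ∀ {u} → u ≋ 0 → g ∣ u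
  ≋0⇒∣ {u} u≋0 = m%n≡0⇒n∣m u g (trans u≋0 0%g≡0)

  ∣-resp-≋ : ∀ {d u v} → d ∣ g → u ≋ v → d ∣ u → d ∣ v
  ∣-resp-≋ d∣g u≋v d∣u = ∣n∣m%n⇒∣m d∣g (subst (_ ∣_) u≋v (%-presˡ-∣ d∣u d∣g))

  *-0ᴳ : ∀ a → a * toℕ 0ᴳ ≋ 0
  *-0ᴳ a = trans (*-congˡ a (toℕ-mod 0)) (cong (_% g) (*-zeroʳ a))

  +-cancelʳ-≋0 : ∀ {u v r} → u + r ≋ 0 → v + r ≋ 0 → u ≋ v
  +-cancelʳ-≋0 {u} {v} {r} u+r≋0 v+r≋0 = begin
      u % g             ≡⟨ sym (%-remove-+ʳ u (≋0⇒∣ v+r≋0)) ⟩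
      (u + (v + r)) % g ≡⟨ cong (_% g) (swap u v r) ⟩
      (v + (u + r)) % g ≡⟨ %-remove-+ʳ v (≋0⇒∣ u+r≋0) ⟩
      v % g             ∎
    where
    open ≡-Reasoning
    swap : ∀ u v r → u + (v + r) ≡ v + (u + r)
    swap u v r = trans (sym (+-assoc u v r)) (trans (cong (_+ r) (+-comm u v)) (+-assoc v u r))

  stable-cancel-≤ : ∀ a {M u v} → gcd (a * M) g ∣ M → u ≤ v → M ∣ u → M ∣ v → a * u ≋ a * v → u ≋ v
  stable-cancel-≤ a {M} {u} {v} stable u≤v M∣u M∣v au≋av = ∣∸⇒≋ u≤v (stable-cancel a stable
    (subst (g ∣_) (sym (*-distribˡ-∸ a v u)) (≋⇒∣∸ (*-monoʳ-≤ a u≤v) au≋av))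
    (∣m+n∣m⇒∣n (subst (M ∣_) (sym (m+[n∸m]≡n u≤v)) M∣v) M∣u))

  stable-cancel-≋ : ∀ a {M u v} → gcd (a * M) g ∣ M → M ∣ u → M ∣ v → a * u ≋ a * v → u ≋ v
  stable-cancel-≋ a {u = u} {v} stable M∣u M∣v au≋av with ≤-total u v
  ... | inj₁ u≤v = stable-cancel-≤ a stable u≤v M∣u M∣v au≋av
  ... | inj₂ v≤u = sym (stable-cancel-≤ a stable v≤u M∣v M∣u (sym au≋av))

  +ᴳ-identityʳ : ∀ x → x +ᴳ 0ᴳ ≡ x
  +ᴳ-identityʳ x = ≋⇒≡ (begin
      toℕ (x +ᴳ 0ᴳ) % g    ≡⟨ toℕ-mod _ ⟩
      (toℕ x + toℕ 0ᴳ) % g ≡⟨ +-cong {toℕ x} refl (toℕ-mod 0) ⟩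
      (toℕ x + 0) % g      ≡⟨ cong (_% g) (+-identityʳ (toℕ x)) ⟩
      toℕ x % g            ∎)
    where open ≡-Reasoning

  +ᴳ-assoc : ∀ x y z → x +ᴳ y +ᴳ z ≡ x +ᴳ (y +ᴳ z)
  +ᴳ-assoc x y z = ≋⇒≡ (begin
      toℕ (x +ᴳ y +ᴳ z) % g             ≡⟨ toℕ-mod _ ⟩
      (toℕ (x +ᴳ y) + toℕ z) % g        ≡⟨ +-cong (toℕ-mod (toℕ x + toℕ y)) refl ⟩
      (toℕ x + toℕ y + toℕ z) % g       ≡⟨ cong (_% g) (+-assoc (toℕ x) (toℕ y) (toℕ z)) ⟩
      (toℕ x + (toℕ y + toℕ z)) % g     ≡⟨ sym (+-cong {toℕ x} refl (toℕ-mod (toℕ y + toℕ z))) ⟩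
      (toℕ x + toℕ (y +ᴳ z)) % g        ≡⟨ sym (toℕ-mod _) ⟩
      toℕ (x +ᴳ (y +ᴳ z)) % g           ∎)
    where open ≡-Reasoning

  ·ᴳ-identityˡ : ∀ x → 1 ·ᴳ x ≡ x
  ·ᴳ-identityˡ x = ≋⇒≡ (trans (toℕ-mod _) (cong (_% g) (*-identityˡ (toℕ x))))

  ·ᴳ-distribʳ-+ : ∀ k l x → (k + l) ·ᴳ x ≡ k ·ᴳ x +ᴳ l ·ᴳ x
  ·ᴳ-distribʳ-+ k l x = ≋⇒≡ (begin
      toℕ ((k + l) ·ᴳ x) % g                ≡⟨ toℕ-mod _ ⟩
      ((k + l) * toℕ x) % g                 ≡⟨ cong (_% g) (*-distribʳ-+ (toℕ x) k l) ⟩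
      (k * toℕ x + l * toℕ x) % g           ≡⟨ sym (+-cong (toℕ-mod (k * toℕ x)) (toℕ-mod (l * toℕ x))) ⟩
      (toℕ (k ·ᴳ x) + toℕ (l ·ᴳ x)) % g     ≡⟨ sym (toℕ-mod _) ⟩
      toℕ (k ·ᴳ x +ᴳ l ·ᴳ x) % g            ∎)
    where open ≡-Reasoning

  ·ᴳ-assoc : ∀ m k x → m ·ᴳ k ·ᴳ x ≡ (m * k) ·ᴳ x
  ·ᴳ-assoc m k x = ≋⇒≡ (begin
      toℕ (m ·ᴳ k ·ᴳ x) % g     ≡⟨ toℕ-mod _ ⟩
      (m * toℕ (k ·ᴳ x)) % g    ≡⟨ *-congˡ m (toℕ-mod (k * toℕ x)) ⟩
      (m * (k * toℕ x)) % g     ≡⟨ cong (_% g) (sym (*-assoc m k (toℕ x))) ⟩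
      (m * k * toℕ x) % g       ≡⟨ sym (toℕ-mod _) ⟩
      toℕ ((m * k) ·ᴳ x) % g    ∎)
    where open ≡-Reasoning

  -- Negation is multiplication by g - 1: both are additive inverses.
  ⊖-as-· : ∀ x → ⊖_ g x ≡ pred g ·ᴳ x
  ⊖-as-· x = ≋⇒≡ (trans (toℕ-mod _)
    (trans (+-cancelʳ-≋0 [g∸x]+x≋0 [g-1]x+x≋0) (sym (toℕ-mod _))))
    where
    [g∸x]+x≋0 : g ∸ toℕ x + toℕ x ≋ 0
    [g∸x]+x≋0 = trans (cong (_% g) (m∸n+n≡m (<⇒≤ (toℕ<n x)))) (trans (n%n≡0 g) (sym 0%g≡0))
    [g-1]x+x≡x*g : pred g * toℕ x + toℕ x ≡ toℕ x * g
    [g-1]x+x≡x*g = trans (+-comm (pred g * toℕ x) (toℕ x))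
      (trans (cong (_* toℕ x) (suc-pred g)) (*-comm g (toℕ x)))
    [g-1]x+x≋0 : pred g * toℕ x + toℕ x ≋ 0
    [g-1]x+x≋0 = trans (cong (_% g) [g-1]x+x≡x*g) (trans (m*n%n≡0 (toℕ x) g) (sym 0%g≡0))

  -- A set closed under translation by some h ≠ 0 is periodic: the cyclic
  -- subgroup generated by h is a nontrivial period.
  translation-periodic : (X : Subset g) (h : G g) → h ≢ 0ᴳ → (∀ {x} → X x → X (x +ᴳ h)) → Periodic g X
  translation-periodic X h h≢0 closed =
    ⟨h⟩ , ⟨h⟩-subgroup , X+⟨h⟩≐X , (h , (1 , sym (·ᴳ-identityˡ h)) , h≢0)
    where
    ⟨h⟩ : Subset g
    ⟨h⟩ z = ∃ λ k → z ≡ k ·ᴳ h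

    ⟨h⟩-subgroup : IsSubgroup g ⟨h⟩
    ⟨h⟩-subgroup = record
      { has-zero = 0 , refl
      ; closed-+ = λ { (k , refl) (l , refl) → k + l , sym (·ᴳ-distribʳ-+ k l h) }
      ; closed-- = λ { (k , refl) → pred g * k , trans (⊖-as-· (k ·ᴳ h)) (·ᴳ-assoc (pred g) k h) }
      }

    closed-multiples : ∀ k {x} → X x → X (x +ᴳ k ·ᴳ h)
    closed-multiples zero {x} x∈X = subst X (sym (+ᴳ-identityʳ x)) x∈X
    closed-multiples (suc k) {x} x∈X = subst X shift (closed-multiples k (closed x∈X))
      where
      shift : x +ᴳ h +ᴳ k ·ᴳ h ≡ x +ᴳ suc k ·ᴳ h
      shift = trans (+ᴳ-assoc x h (k ·ᴳ h)) (cong (x +ᴳ_)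
        (trans (cong (_+ᴳ k ·ᴳ h) (sym (·ᴳ-identityˡ h))) (sym (·ᴳ-distribʳ-+ 1 k h))))

    X+⟨h⟩≐X : _≐_ g (_⊞_ g X ⟨h⟩) X
    X+⟨h⟩≐X z = mk⇔ (λ { (s , _ , s∈X , (k , refl) , refl) → closed-multiples k s∈X })
                    (λ z∈X → z , 0ᴳ , z∈X , (0 , refl) , sym (+ᴳ-identityʳ z))

  multiple-∈-multiplesOf : ∀ {q} (y : G g) → q ∣ toℕ y → multiplesOf g q y
  multiple-∈-multiplesOf {q} y (divides t y≡t*q) = t mod g , ≋⇒≡ (begin
      toℕ y % g                 ≡⟨ cong (_% g) (trans y≡t*q (*-comm t q)) ⟩
      (q * t) % g               ≡⟨ *-congˡ q (sym (toℕ-mod t)) ⟩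
      (q * toℕ (t mod g)) % g   ≡⟨ sym (toℕ-mod _) ⟩
      toℕ (q ·ᴳ (t mod g)) % g  ∎)
    where open ≡-Reasoning

module Setting (g : ℕ) .{{_ : NonZero g}} (X : Subset g) (a b : ℕ) (0∈X : X (𝟘 g))
  (a⊥b : Coprime a b) (sumset≐ : _≐_ g (dilSum g a b X) (scale g a X)) where

  open Residues g

  dilate : ∀ {x y} → X x → X y → ∃ λ s → X s × a * toℕ x + b * toℕ y ≋ a * toℕ s
  dilate {x} {y} x∈X y∈X with Equivalence.to (sumset≐ _) (x , y , x∈X , y∈X , refl)
  ... | s , s∈X , ax+by≡as = s , s∈X , (begin
      (a * toℕ x + b * toℕ y) % g         ≡⟨ sym (+-cong (toℕ-mod (a * toℕ x)) (toℕ-mod (b * toℕ y))) ⟩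
      (toℕ (a ·ᴳ x) + toℕ (b ·ᴳ y)) % g   ≡⟨ sym (toℕ-mod _) ⟩
      toℕ (a ·ᴳ x +ᴳ b ·ᴳ y) % g          ≡⟨ cong (λ z → toℕ z % g) ax+by≡as ⟩
      toℕ (a ·ᴳ s) % g                    ≡⟨ toℕ-mod _ ⟩
      (a * toℕ s) % g                     ∎)
    where open ≡-Reasoning

  dilate₀ : ∀ {y} → X y → ∃ λ s → X s × b * toℕ y ≋ a * toℕ s
  dilate₀ {y} y∈X with dilate 0∈X y∈X
  ... | s , s∈X , a0+by≋as = s , s∈X , trans (sym (+-cong (*-0ᴳ a) refl)) a0+by≋as

  M : ℕ → ℕ
  M k = gcd (a ^ k) g

  M-ascending : ∀ k → M k ∣ M (suc k)
  M-ascending k = gcd-greatest (∣-trans (gcd[m,n]∣m (a ^ k) g) (n∣m*n a)) (gcd[m,n]∣n (a ^ k) g)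

  M-stabilises : ∃ λ K → M (suc K) ∣ M K
  M-stabilises = divisor-chain-stabilises g M M-ascending (λ k → gcd[m,n]∣n (a ^ k) g)

  K : ℕ
  K = proj₁ M-stabilises

  M-stable : gcd (a * M K) g ∣ M K
  M-stable = ∣-trans (gcd-*-gcd-∣-gcd-* a (a ^ K) g) (proj₂ M-stabilises)

  -- Every element of X is a multiple of every M k: from b·y = a·s with
  -- M k ∣ s we get M (k+1) ∣ b·y, and M (k+1) is coprime to b.
  M∣X : ∀ k {y} → X y → M k ∣ toℕ y
  M∣X zero _ = ∣-trans (gcd[m,n]∣m 1 g) (1∣ _)
  M∣X (suc k) {y} y∈X with dilate₀ y∈X
  ... | s , s∈X , by≋as = coprime-divisor M⊥b M∣by
    where
    M∣as : M (suc k) ∣ a * toℕ s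
    M∣as = ∣-trans (gcd-*-∣-*-gcd a (a ^ k) g) (*-monoʳ-∣ a (M∣X k s∈X))
    M∣by : M (suc k) ∣ b * toℕ y
    M∣by = ∣-resp-≋ (gcd[m,n]∣n (a ^ suc k) g) (sym by≋as) M∣as
    M⊥b : Coprime (M (suc k)) b
    M⊥b (i∣M , i∣b) = coprime-pow a⊥b (suc k) (∣-trans i∣M (gcd[m,n]∣m (a ^ suc k) g) , i∣b)

  translation-closed : ∀ {y s₀} → X y → X s₀ → b * toℕ y ≋ a * toℕ s₀ → ∀ {x} → X x → X (x +ᴳ s₀)
  translation-closed {y} {s₀} y∈X s₀∈X by≋as₀ {x} x∈X with dilate x∈X y∈X
  ... | s , s∈X , ax+by≋as = subst X (sym (≋⇒≡ x+s₀≋s)) s∈X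
    where
    a[x+s₀]≋as : a * (toℕ x + toℕ s₀) ≋ a * toℕ s
    a[x+s₀]≋as = trans (cong (_% g) (*-distribˡ-+ a (toℕ x) (toℕ s₀)))
      (trans (+-cong {a * toℕ x} refl (sym by≋as₀)) ax+by≋as)
    x+s₀≋s : toℕ (x +ᴳ s₀) ≋ toℕ s
    x+s₀≋s = trans (toℕ-mod _)
      (stable-cancel-≋ a M-stable (∣m∣n⇒∣m+n (M∣X K x∈X) (M∣X K s₀∈X)) (M∣X K s∈X) a[x+s₀]≋as)

  -- If X is not periodic then b annihilates X: the s₀ with b·y = a·s₀ must be 0.
  b-annihilates : ¬ Periodic g X → ∀ {y} → X y → g ∣ b * toℕ y
  b-annihilates aperiodic {y} y∈X with dilate₀ y∈X
  ... | s₀ , s₀∈X , by≋as₀ with s₀ ≟ᴳ 0ᴳ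
  ...   | yes refl = ≋0⇒∣ (trans by≋as₀ (*-0ᴳ a))
  ...   | no s₀≢0 = ⊥-elim (aperiodic (translation-periodic X s₀ s₀≢0 (translation-closed y∈X s₀∈X by≋as₀)))

lemma5p2 : (g : ℕ) .{{_ : NonZero g}} (X : Subset g) (a b : ℕ) → X (𝟘 g) → 0 < a → 0 < b → gcd a b ≡ 1 → ¬ Periodic g X → _≐_ g (dilSum g a b X) (scale g a X) → X ⊆ multiplesOf g (g/gcd g b)
lemma5p2 g X a b 0∈X _ _ gcd[a,b]≡1 aperiodic sumset≐ {y} y∈X =
  multiple-∈-multiplesOf y (cofactor-∣ g b (toℕ y) (b-annihilates aperiodic y∈X))
  where
  open Residues g
  open Setting g X a b 0∈X (gcd≡1⇒coprime gcd[a,b]≡1) sumset≐
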